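{- If an ideal $\mathcal I$ on $\omega$ is a P$^+$-ideal, then $\mathcal I$ is an HL ideal.
   Context: Ideals are proper, closed under subsets and finite unions, and contain all finite sets; $\mathcal I^+=\mathcal P(\omega)\setminus\mathcal I$. $\mathcal I$ is a P$^+$-ideal if for every sequence $(X_n)_{n\in\omega}$ of sets in $\mathcal I^+$ there are finite sets $y_n\subseteq X_n$ with $\bigcup_n y_n\in\mathcal I^+$. A tree is an initial subset of $(2^{<\omega},\subseteq)$ without maximal elements, perfect if every node has two incompatible extensions in it; $\mathbf S$ is the set of perfect trees; $p\restriction A=\{s\in p\cap2^n:n\in A\}$. An ideal $\mathcal I$ is HL if for every $c:2^{<\omega}\to2$ there are $p\in\mathbf S$ and $A\in\mathcal I^+$ with $c$ constant on $p\restriction A$. -}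

module Defs where

open import Data.Nat using (ℕ; _<_)
open import Data.Bool using (Bool)
open import Data.List using (List; []; _++_; length)
open import Data.List.Membership.Propositional using (_∈_)
open import Data.List.Relation.Unary.All using (All)
open import Data.Product using (Σ; ∃; _×_; _,_)
open import Relation.Binary.PropositionalEquality using (_≡_; _≢_)
open import Relation.Nullary using (¬_)
open import Data.Unit using (⊤)
open import Data.Sum using (_⊎_)

Subset : Set₁
Subset = ℕ → Set

_⊆_ : Subset → Subset → Set
A ⊆ B = ∀ n → A n → B n

_∪_ : Subset → Subset → Subset
(A ∪ B) n = A n ⊎ B n

ω : Subset
ω _ = ⊤

Finite : Subset → Set
Finite A = Σ ℕ (λ N → ∀ n → A n → n < N)

⟦_⟧ : List ℕ → Subset
⟦ ys ⟧ n = n ∈ ys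

record IsIdeal (I : Subset → Set) : Set₁ where
  field
    proper     : ¬ I ω
    ⊆-closed   : ∀ {A B} → A ⊆ B → I B → I A
    ∪-closed   : ∀ {A B} → I A → I B → I (A ∪ B)
    fin-member : ∀ {A} → Finite A → I A

Positive : (Subset → Set) → Subset → Set
Positive I A = ¬ I A

IsP⁺ : (Subset → Set) → Set₁
IsP⁺ I =
  (X : ℕ → Subset) → (∀ n → Positive I (X n)) →
  Σ (ℕ → List ℕ) (λ y →
    (∀ n → All (λ m → X n m) (y n)) ×
    Positive I (λ m → Σ ℕ (λ n → m ∈ y n)))

Node : Set
Node = List Bool

_⊑_ : Node → Node → Set
s ⊑ t = Σ Node (λ u → s ++ u ≡ t)

_⊏_ : Node → Node → Set
s ⊏ t = (s ⊑ t) × (s ≢ t)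

Incompatible : Node → Node → Set
Incompatible s t = ¬ (s ⊑ t) × ¬ (t ⊑ s)

record IsTree (p : Node → Set) : Set where
  field
    root    : p []
    initial : ∀ {s t} → s ⊑ t → p t → p s
    no-max  : ∀ {s} → p s → Σ Node (λ t → p t × s ⊏ t)

record IsPerfect (p : Node → Set) : Set where
  field
    tree    : IsTree p
    split   : ∀ {s} → p s → Σ Node (λ t → Σ Node (λ u →
                p t × p u × s ⊑ t × s ⊑ u × Incompatible t u))

_↾_ : (Node → Set) → Subset → Node → Set
(p ↾ A) s = p s × A (length s)

ConstantOn : (Node → Bool) → (Node → Set) → Set
ConstantOn c P = Σ Bool (λ i → ∀ s → P s → c s ≡ i)

IsHL : (Subset → Set) → Set₁
IsHL I = (c : Node → Bool) →
  Σ (Node → Set) (λ p → Σ Subset (λ A →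
    IsPerfect p × Positive I A × ConstantOn c (p ↾ A)))

-- A branch x has colour c (x ↾ m) at level m. By excluded middle, either for every positive
-- finite intersection W of such colour classes and every node there is a branch through the
-- node that is false on a positive part of W, or some node t₀ and some such W₀ block this;
-- then every branch above t₀ is true on a positive part of every positive subset of W₀. So for
-- one colour i a branch through every node (above t₀) can be chosen greedily, level by level,
-- keeping the set Z L of levels where all branches chosen up to length L have colour i
-- positive. P⁺ applied to Z (n + 1) ∖ [0, n] gives finite sets with positive union Y; cut ω
-- into blocks [a j, a (j + 1)) so fast growing that the points contributed from a block lie
-- below a (j + 2). Up to a finite set Y is covered by the even and the odd such windows, one
-- of which is positive; the perfect tree that forks off chosen branches at the window ends
-- has colour i on that window.

module Submission where

open import Defs
open import Level using (0ℓ)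
open import Axiom.ExcludedMiddle using (ExcludedMiddle)
open import Function using (_∘_)
open import Data.Nat using (ℕ; zero; suc; _+_; _≤_; _<_; _≤?_; _<?_; z≤n; s≤s; _≤′_; ≤′-refl; ≤′-step)
open import Data.Nat.Properties
  using (≤-refl; ≤-trans; <-trans; <⇒≤; ≤-<-trans; ≰⇒>; ≮⇒≥; <⇒≱; n≤1+n; m≤m+n; m≤n+m; ≤⇒≤′; m+1+n≢m; 1+n≢n; +-comm)
open import Data.Bool using (Bool; true; false; not)
open import Data.Bool.Properties using (not-¬)
open import Data.List using (List; []; _∷_; _++_; _∷ʳ_; length; replicate; cartesianProductWith)
open import Data.List.Properties using (∷-injective; ∷ʳ-injective; ++-identityʳ; ++-assoc; length-++)
open import Data.List.Extrema.Nat using (max; ⊥≤max; xs≤max)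
open import Data.List.Membership.Propositional using (_∈_)
open import Data.List.Membership.Propositional.Properties using (∈-cartesianProductWith⁺)
open import Data.List.Relation.Unary.Any using (here; there)
open import Data.List.Relation.Unary.All as All using (All; []; _∷_)
open import Data.Product using (Σ; ∃; _×_; _,_; proj₁; proj₂)
open import Data.Sum using (_⊎_; inj₁; inj₂; swap)
open import Data.Empty using (⊥-elim)
open import Relation.Binary using (Rel; Reflexive; Transitive)
open import Relation.Nullary using (yes; no; contradiction)
open import Relation.Binary.PropositionalEquality
  using (_≡_; refl; sym; trans; cong; subst; subst₂)

⊆-trans : ∀ {A B C} → A ⊆ B → B ⊆ C → A ⊆ C
⊆-trans A⊆B B⊆C n = B⊆C n ∘ A⊆B n

below-finite : ∀ N → Finite (_< N)
below-finite N = N , λ _ n<N → n<N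

module _ {I : Subset → Set} (ideal : IsIdeal I) where
  open IsIdeal ideal

  positive-⊆-∪ : ∀ {A B C} → Positive I A → A ⊆ (B ∪ C) → I C → Positive I B
  positive-⊆-∪ A⁺ A⊆B∪C C∈I B∈I = A⁺ (⊆-closed A⊆B∪C (∪-closed B∈I C∈I))

  positive-⊆-∪-finite : ∀ {A B F} → Positive I A → A ⊆ (B ∪ F) → Finite F → Positive I B
  positive-⊆-∪-finite A⁺ A⊆B∪F F-finite = positive-⊆-∪ A⁺ A⊆B∪F (fin-member F-finite)

  positive-∪ : ExcludedMiddle 0ℓ → ∀ {A B} → Positive I (A ∪ B) → Positive I A ⊎ Positive I B
  positive-∪ em {A} A∪B⁺ with em {I A}
  ... | no  A∉I = inj₁ A∉I
  ... | yes A∈I = inj₂ (positive-⊆-∪ A∪B⁺ (λ _ → swap) A∈I)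

≤-step-monotone : ∀ {a r} {A : Set a} (_R_ : Rel A r) → Reflexive _R_ → Transitive _R_ →
                  (f : ℕ → A) → (∀ n → f n R f (suc n)) → ∀ {m n} → m ≤ n → f m R f n
≤-step-monotone _R_ refl′ trans′ f step m≤n = go (≤⇒≤′ m≤n)
  where
  go : ∀ {m n} → m ≤′ n → f m R f n
  go ≤′-refl      = refl′
  go (≤′-step m≤′n) = trans′ (go m≤′n) (step _)

StrictlyIncreasing : (ℕ → ℕ) → Set
StrictlyIncreasing f = ∀ n → f n < f (suc n)

module _ {f : ℕ → ℕ} (f-inc : StrictlyIncreasing f) where

  StrictlyIncreasing⇒monotone : ∀ {m n} → m ≤ n → f m ≤ f n
  StrictlyIncreasing⇒monotone = ≤-step-monotone _≤_ ≤-refl ≤-trans f (<⇒≤ ∘ f-inc)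

  StrictlyIncreasing⇒inflationary : ∀ n → n ≤ f n
  StrictlyIncreasing⇒inflationary zero    = z≤n
  StrictlyIncreasing⇒inflationary (suc n) = ≤-<-trans (StrictlyIncreasing⇒inflationary n) (f-inc n)

antitone : (Z : ℕ → Subset) → (∀ n → Z (suc n) ⊆ Z n) → ∀ {m n} → m ≤ n → Z n ⊆ Z m
antitone = ≤-step-monotone (λ A B → B ⊆ A) (λ _ z → z) (λ B⊆A C⊆B → ⊆-trans C⊆B B⊆A)

bracket : (a : ℕ → ℕ) → ∀ j {n} → a 0 ≤ n → n < a j → ∃ λ i → a i ≤ n × n < a (suc i)
bracket a zero    a₀≤n n<a₀ = contradiction a₀≤n (<⇒≱ n<a₀)
bracket a (suc j) {n} a₀≤n n<a with n <? a j
... | yes n<aj = bracket a j a₀≤n n<aj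
... | no  n≮aj = j , ≮⇒≥ n≮aj , n<a

twice : ℕ → ℕ
twice zero    = zero
twice (suc k) = suc (suc (twice k))

even-or-odd : ∀ j → ∃ λ k → j ≡ twice k ⊎ j ≡ suc (twice k)
even-or-odd zero = zero , inj₁ refl
even-or-odd (suc j) with even-or-odd j
... | k , inj₁ refl = k , inj₂ refl
... | k , inj₂ refl = suc k , inj₁ refl

⊑-trans : ∀ {s t r} → s ⊑ t → t ⊑ r → s ⊑ r
⊑-trans {s} (u , refl) (v , refl) = u ++ v , sym (++-assoc s u v)

⊑-length-≡ : ∀ {s t} → s ⊑ t → length s ≡ length t → s ≡ t
⊑-length-≡ {s} ([]    , refl) _   = sym (++-identityʳ s)
⊑-length-≡ {s} (_ ∷ _ , refl) len = contradiction (sym (trans len (length-++ s))) (m+1+n≢m (length s))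

∷ʳ-⊑-injective : ∀ P {b b′} → (P ∷ʳ b) ⊑ (P ∷ʳ b′) → b ≡ b′
∷ʳ-⊑-injective P P∷ʳb⊑P∷ʳb′ =
  proj₂ (∷ʳ-injective P P (⊑-length-≡ P∷ʳb⊑P∷ʳb′ (trans (length-++ P) (sym (length-++ P)))))

∷ʳ-incompatible : ∀ P b → Incompatible (P ∷ʳ b) (P ∷ʳ not b)
∷ʳ-incompatible P b = not-¬ refl ∘ ∷ʳ-⊑-injective P , not-¬ refl ∘ sym ∘ ∷ʳ-⊑-injective P

nodesOfLength : ℕ → List Node
nodesOfLength zero    = [] ∷ []
nodesOfLength (suc n) = cartesianProductWith _∷_ (false ∷ true ∷ []) (nodesOfLength n)

∈-nodesOfLength : ∀ t → t ∈ nodesOfLength (length t)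
∈-nodesOfLength []      = here refl
∈-nodesOfLength (b ∷ t) = ∈-cartesianProductWith⁺ _∷_ (∈-bits b) (∈-nodesOfLength t)
  where
  ∈-bits : ∀ b → b ∈ (false ∷ true ∷ [])
  ∈-bits false = here refl
  ∈-bits true  = there (here refl)

Branch : Set
Branch = ℕ → Bool

prefix : ℕ → Branch → Node
prefix zero    x = []
prefix (suc n) x = x 0 ∷ prefix n (x ∘ suc)

Through : Branch → Node → Set
Through x t = prefix (length t) x ≡ t

length-prefix : ∀ n x → length (prefix n x) ≡ n
length-prefix zero    x = refl
length-prefix (suc n) x = cong suc (length-prefix n (x ∘ suc))

prefix-suc : ∀ n x → prefix (suc n) x ≡ prefix n x ∷ʳ x n
prefix-suc zero    x = refl
prefix-suc (suc n) x = cong (x 0 ∷_) (prefix-suc n (x ∘ suc))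

prefix-⊑ : ∀ {m n} x → m ≤ n → prefix m x ⊑ prefix n x
prefix-⊑ {n = n} x z≤n     = prefix n x , refl
prefix-⊑         x (s≤s h) with prefix-⊑ (x ∘ suc) h
... | u , e = u , cong (x 0 ∷_) e

through-prefix : ∀ n x → Through x (prefix n x)
through-prefix n x = cong (λ k → prefix k x) (length-prefix n x)

prefix-++ : ∀ s {u} n x → s ++ u ≡ prefix n x → Through x s
prefix-++ []      n       x e = refl
prefix-++ (b ∷ s) zero    x ()
prefix-++ (b ∷ s) (suc n) x e with ∷-injective e
... | refl , e′ = cong (b ∷_) (prefix-++ s n (x ∘ suc) e′)

through-⊑ : ∀ {x s t} → s ⊑ t → Through x t → Through x s
through-⊑ {x} {s} {t} (u , e) x-through-t = prefix-++ s (length t) x (trans e (sym x-through-t))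

through⇒⊑-prefix : ∀ {x s n} → Through x s → length s ≤ n → s ⊑ prefix n x
through⇒⊑-prefix {x} x-through-s h = subst (_⊑ _) x-through-s (prefix-⊑ x h)

prefix-agree : ∀ {m n} x x′ → m ≤ n → prefix n x ≡ prefix n x′ → prefix m x ≡ prefix m x′
prefix-agree {m} x x′ m≤n e =
  subst (λ k → prefix k x ≡ prefix m x′) (length-prefix m x′)
        (through-⊑ (subst (_ ⊑_) (sym e) (prefix-⊑ x′ m≤n)) (through-prefix _ x))

extendByFalse : Node → Branch
extendByFalse []      _       = false
extendByFalse (b ∷ t) zero    = b
extendByFalse (b ∷ t) (suc n) = extendByFalse t n

through-extendByFalse : ∀ t → Through (extendByFalse t) t
through-extendByFalse []      = refl
through-extendByFalse (b ∷ t) = cong (b ∷_) (through-extendByFalse t)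

Hits : (Node → Bool) → Bool → Branch → Subset
Hits c i x m = c (prefix m x) ≡ i

Levels : (Node → Bool) → List (Branch × Bool) → Subset
Levels c ps m = All (λ (x , i) → Hits c i x m) ps

Extendable : (Subset → Set) → (Node → Bool) → Bool → Node → List (Branch × Bool) → Set
Extendable I c i s₀ ps₀ =
  ∀ ps → Levels c ps ⊆ Levels c ps₀ → Positive I (Levels c ps) →
  ∀ {t} → s₀ ⊑ t → Σ Branch λ x → Through x t × Positive I (Levels c ((x , i) ∷ ps))

record BranchSelection (I : Subset → Set) (c : Node → Bool) (i : Bool) (s₀ : Node) : Set₁ where
  field
    branch         : Node → Branch
    through-branch : ∀ t → Through (branch t) t
    Z              : ℕ → Subset
    Z-positive     : ∀ L → Positive I (Z L)
    Z-decreasing   : ∀ L → Z (suc L) ⊆ Z L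
    Z-hits         : ∀ {L t} → s₀ ⊑ t → length t ≤ L → Z L ⊆ Hits c i (branch t)

HomogeneousTree : (Subset → Set) → (Node → Bool) → Set₁
HomogeneousTree I c = Σ (Node → Set) λ p → Σ Subset λ A →
  IsPerfect p × Positive I A × ConstantOn c (p ↾ A)

Window : (ℕ → ℕ) → (ℕ → Subset) → Subset
Window ℓ Z m = Σ ℕ λ k → m ≤ ℓ (suc k) × Z (suc (ℓ k)) m

module _ {I : Subset → Set} (em : ExcludedMiddle 0ℓ) (ideal : IsIdeal I) (c : Node → Bool) where
  open IsIdeal ideal

  Blocked : Set
  Blocked = Σ (List (Branch × Bool)) λ ps → Positive I (Levels c ps) × Σ Node λ t →
            ∀ x → Through x t → I (Levels c ((x , false) ∷ ps))

  extendable-dichotomy : Σ Bool λ i → Σ Node λ s₀ → Σ (List (Branch × Bool)) λ ps₀ →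
                         Positive I (Levels c ps₀) × Extendable I c i s₀ ps₀
  extendable-dichotomy with em {Blocked}
  ... | no ¬blocked = false , [] , [] , all-levels-positive , extend-false
    where
    all-levels-positive : Positive I (Levels c [])
    all-levels-positive all∈I = proper (⊆-closed (λ _ _ → []) all∈I)

    extend-false : Extendable I c false [] []
    extend-false ps _ ps⁺ {t} _
      with em {Σ Branch λ x → Through x t × Positive I (Levels c ((x , false) ∷ ps))}
    ... | yes extension = extension
    ... | no ¬extension = ⊥-elim (¬blocked (ps , ps⁺ , t , null))
      where
      null : ∀ x → Through x t → I (Levels c ((x , false) ∷ ps))
      null x x-through-t with em {I (Levels c ((x , false) ∷ ps))}
      ... | yes ∈I = ∈I
      ... | no  ∉I = ⊥-elim (¬extension (x , x-through-t , ∉I))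
  ... | yes (ps₀ , ps₀⁺ , t₀ , null) = true , t₀ , ps₀ , ps₀⁺ , extend-true
    where
    extend-true : Extendable I c true t₀ ps₀
    extend-true ps ps⊆ps₀ ps⁺ {t} t₀⊑t =
      x , through-extendByFalse t ,
      positive-⊆-∪ ideal ps⁺ split (null x (through-⊑ t₀⊑t (through-extendByFalse t)))
      where
      x : Branch
      x = extendByFalse t

      split : Levels c ps ⊆ (Levels c ((x , true) ∷ ps) ∪ Levels c ((x , false) ∷ ps₀))
      split m m∈ps with c (prefix m x) in colour
      ... | true  = inj₁ (colour ∷ m∈ps)
      ... | false = inj₂ (colour ∷ ps⊆ps₀ m m∈ps)

module Greedy {I : Subset → Set} (em : ExcludedMiddle 0ℓ) (c : Node → Bool) {i : Bool} {s₀ : Node}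
  {ps₀ : List (Branch × Bool)} (extend : Extendable I c i s₀ ps₀) (ps₀⁺ : Positive I (Levels c ps₀)) where

  record State : Set where
    field
      constraints : List (Branch × Bool)
      inside      : Levels c constraints ⊆ Levels c ps₀
      positive    : Positive I (Levels c constraints)
  open State

  region : State → Subset
  region S = Levels c (constraints S)

  Choice : State → Node → Set
  Choice S t = Σ Branch λ x → Through x t × (s₀ ⊑ t → region S ⊆ Hits c i x)

  choice-⊆ : ∀ {S S′ t} → region S′ ⊆ region S → Choice S t → Choice S′ t
  choice-⊆ S′⊆S (x , x-through-t , hits) = x , x-through-t , λ s₀⊑t → ⊆-trans S′⊆S (hits s₀⊑t)

  record Refinement (S : State) (ts : List Node) : Set where
    field
      state   : State
      shrinks : region state ⊆ region S
      choices : All (Choice state) ts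
  open Refinement

  refineAt : (S : State) (t : Node) → Refinement S (t ∷ [])
  refineAt S t with em {s₀ ⊑ t}
  ... | yes s₀⊑t = add (extend (constraints S) (inside S) (positive S) s₀⊑t)
    where
    add : Σ Branch (λ x → Through x t × Positive I (Levels c ((x , i) ∷ constraints S))) →
          Refinement S (t ∷ [])
    add (x , x-through-t , x⁺) = record
      { state   = record { constraints = (x , i) ∷ constraints S
                         ; inside      = λ m → inside S m ∘ All.tail
                         ; positive    = x⁺ }
      ; shrinks = λ _ → All.tail
      ; choices = (x , x-through-t , λ _ _ → All.head) ∷ [] }
  ... | no s₀⋢t = record
    { state   = S
    ; shrinks = λ _ m∈S → m∈S
    ; choices = (extendByFalse t , through-extendByFalse t , ⊥-elim ∘ s₀⋢t) ∷ [] }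

  refine : (S : State) (ts : List Node) → Refinement S ts
  refine S []       = record { state = S ; shrinks = λ _ m∈S → m∈S ; choices = [] }
  refine S (t ∷ ts) = record
    { state   = state R₂
    ; shrinks = ⊆-trans (shrinks R₂) (shrinks R₁)
    ; choices = choice-⊆ {state R₁} {state R₂} {t} (shrinks R₂) (All.head (choices R₁)) ∷ choices R₂ }
    where
    R₁ = refineAt S t
    R₂ = refine (state R₁) ts

  mutual
    before : ℕ → State
    before zero    = record { constraints = ps₀ ; inside = λ _ m∈ps₀ → m∈ps₀ ; positive = ps₀⁺ }
    before (suc L) = state (stage L)

    stage : (L : ℕ) → Refinement (before L) (nodesOfLength L)
    stage L = refine (before L) (nodesOfLength L)

  choice : (t : Node) → Choice (state (stage (length t))) t
  choice t = All.lookup (choices (stage (length t))) (∈-nodesOfLength t)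

  selection : BranchSelection I c i s₀
  selection = record
    { branch         = λ t → proj₁ (choice t)
    ; through-branch = λ t → proj₁ (proj₂ (choice t))
    ; Z              = Z
    ; Z-positive     = λ L → positive (state (stage L))
    ; Z-decreasing   = Z-decreasing
    ; Z-hits         = λ {_} {t} s₀⊑t |t|≤L →
                         ⊆-trans (antitone Z Z-decreasing |t|≤L) (proj₂ (proj₂ (choice t)) s₀⊑t) }
    where
    Z : ℕ → Subset
    Z L = region (state (stage L))

    Z-decreasing : ∀ L → Z (suc L) ⊆ Z L
    Z-decreasing L = shrinks (stage (suc L))

module LevelTree {I : Subset → Set} {c : Node → Bool} {i : Bool} {s₀ : Node}
  (B : BranchSelection I c i s₀) {ℓ : ℕ → ℕ} (ℓ-inc : StrictlyIncreasing ℓ) (s₀≤ℓ₀ : length s₀ ≤ ℓ 0) where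
  open BranchSelection B

  ℓ-mono : ∀ {m n} → m ≤ n → ℓ m ≤ ℓ n
  ℓ-mono = StrictlyIncreasing⇒monotone ℓ-inc

  -- A code is read from its last entry to its first: an entry true followed by k further
  -- entries forks off the branch built so far at level ℓ k.
  forkLevel : List Bool → ℕ
  forkLevel σ = ℓ (length σ)

  node : List Bool → Node
  node []          = s₀
  node (false ∷ σ) = node σ
  node (true ∷ σ)  = prefix (forkLevel σ) (branch (node σ)) ∷ʳ not (branch (node σ) (forkLevel σ))

  β : List Bool → Branch
  β σ = branch (node σ)

  length-fork : ∀ σ → length (node (true ∷ σ)) ≡ suc (forkLevel σ)
  length-fork σ = trans (length-++ (prefix (forkLevel σ) (β σ)))
                        (trans (cong (_+ 1) (length-prefix (forkLevel σ) (β σ))) (+-comm _ 1))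

  mutual
    length-node : ∀ σ → length (node σ) ≤ forkLevel σ
    length-node []      = s₀≤ℓ₀
    length-node (b ∷ σ) = ≤-trans (length-node-∷ b σ) (ℓ-inc (length σ))

    length-node-∷ : ∀ b σ → length (node (b ∷ σ)) ≤ suc (forkLevel σ)
    length-node-∷ false σ = ≤-trans (length-node σ) (n≤1+n _)
    length-node-∷ true  σ = subst (_≤ _) (sym (length-fork σ)) ≤-refl

  s₀⊑node : ∀ σ → s₀ ⊑ node σ
  s₀⊑node []          = [] , ++-identityʳ s₀
  s₀⊑node (false ∷ σ) = s₀⊑node σ
  s₀⊑node (true ∷ σ)  =
    ⊑-trans (s₀⊑node σ) (⊑-trans (through⇒⊑-prefix (through-branch (node σ)) (length-node σ))
                                  (_ , refl))

  β-fork : ∀ σ → prefix (suc (forkLevel σ)) (β (true ∷ σ)) ≡ node (true ∷ σ)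
  β-fork σ = subst (λ n → prefix n (β (true ∷ σ)) ≡ node (true ∷ σ)) (length-fork σ)
                   (through-branch (node (true ∷ σ)))

  β-fork-split : ∀ σ → prefix (forkLevel σ) (β (true ∷ σ)) ≡ prefix (forkLevel σ) (β σ)
                     × β (true ∷ σ) (forkLevel σ) ≡ not (β σ (forkLevel σ))
  β-fork-split σ = ∷ʳ-injective (prefix (forkLevel σ) (β (true ∷ σ))) (prefix (forkLevel σ) (β σ))
                                 (trans (sym (prefix-suc _ _)) (β-fork σ))

  prefix-β-∷ : ∀ b σ {m} → m ≤ forkLevel σ → prefix m (β (b ∷ σ)) ≡ prefix m (β σ)
  prefix-β-∷ false σ _   = refl
  prefix-β-∷ true  σ m≤ℓ = prefix-agree (β (true ∷ σ)) (β σ) m≤ℓ (proj₁ (β-fork-split σ))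

  β-padded : ∀ r σ → β (replicate r false ++ σ) ≡ β σ
  β-padded zero    σ = refl
  β-padded (suc r) σ = β-padded r σ

  p : Node → Set
  p s = Σ (List Bool) λ σ → Through (β σ) s

  p-no-max : ∀ {s} → p s → Σ Node λ t → p t × s ⊏ t
  p-no-max {s} (σ , β-through-s) =
    prefix n (β σ) , (σ , through-prefix n (β σ)) , through⇒⊑-prefix β-through-s (n≤1+n _) ,
    λ s≡t → 1+n≢n (sym (trans (cong length s≡t) (length-prefix n (β σ))))
    where
    n = suc (length s)

  p-tree : IsTree p
  p-tree = record
    { root    = [] , refl
    ; initial = λ s⊑t (σ , β-through-t) → σ , through-⊑ s⊑t β-through-t
    ; no-max  = p-no-max }

  padding≤length : ∀ r σ → r ≤ length (replicate r false ++ σ)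
  padding≤length zero    σ = z≤n
  padding≤length (suc r) σ = s≤s (padding≤length r σ)

  p-split : ∀ {s} → p s → Σ Node λ t → Σ Node λ u →
            p t × p u × s ⊑ t × s ⊑ u × Incompatible t u
  p-split {s} (σ , β-through-s) =
    prefix (suc ℓ′) (β σ′) , prefix (suc ℓ′) (β (true ∷ σ′)) ,
    (σ′ , through-prefix _ (β σ′)) , (true ∷ σ′ , through-prefix _ (β (true ∷ σ′))) ,
    through⇒⊑-prefix β′-through-s (≤-trans n≤ℓ′ (n≤1+n _)) ,
    through⇒⊑-prefix βtrue-through-s (≤-trans n≤ℓ′ (n≤1+n _)) ,
    subst₂ Incompatible (sym (prefix-suc ℓ′ (β σ′))) (sym (β-fork σ′)) (∷ʳ-incompatible _ _)
    where
    n  = length s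
    σ′ = replicate n false ++ σ
    ℓ′ = ℓ (length σ′)

    n≤ℓ′ : n ≤ ℓ′
    n≤ℓ′ = ≤-trans (padding≤length n σ) (StrictlyIncreasing⇒inflationary ℓ-inc _)

    β′-through-s : Through (β σ′) s
    β′-through-s = subst (λ x → Through x s) (sym (β-padded n σ)) β-through-s

    βtrue-through-s : Through (β (true ∷ σ′)) s
    βtrue-through-s = trans (prefix-β-∷ true σ′ n≤ℓ′) β′-through-s

  p-perfect : IsPerfect p
  p-perfect = record { tree = p-tree ; split = p-split }

  shorten : ∀ {k m} → m ≤ ℓ (suc k) → ∀ σ → Σ (List Bool) λ σ′ →
            length (node σ′) ≤ suc (ℓ k) × prefix m (β σ) ≡ prefix m (β σ′)
  shorten _ [] = [] , ≤-trans s₀≤ℓ₀ (≤-trans (ℓ-mono z≤n) (n≤1+n _)) , refl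
  shorten {k} m≤ℓk+1 (b ∷ σ) with length σ ≤? k
  ... | yes |σ|≤k = b ∷ σ , ≤-trans (length-node-∷ b σ) (s≤s (ℓ-mono |σ|≤k)) , refl
  ... | no  |σ|≰k with shorten m≤ℓk+1 σ
  ...   | σ′ , short , agree =
    σ′ , short , trans (prefix-β-∷ b σ (≤-trans m≤ℓk+1 (ℓ-mono (≰⇒> |σ|≰k)))) agree

  p-constant : ConstantOn c (p ↾ Window ℓ Z)
  p-constant = i , λ s (p-s , window) → colour p-s window
    where
    colour : ∀ {s} → p s → Window ℓ Z (length s) → c s ≡ i
    colour {s} (σ , β-through-s) (k , m≤ℓk+1 , z) with shorten m≤ℓk+1 σ
    ... | σ′ , short , agree =
      trans (cong c (trans (sym β-through-s) agree)) (Z-hits (s₀⊑node σ′) short (length s) z)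

module Homogeneous {I : Subset → Set} (em : ExcludedMiddle 0ℓ) (ideal : IsIdeal I) (P⁺ : IsP⁺ I)
  {c : Node → Bool} {i : Bool} {s₀ : Node} (B : BranchSelection I c i s₀) where
  open BranchSelection B

  X : ℕ → Subset
  X n m = Z (suc n) m × n < m

  X-positive : ∀ n → Positive I (X n)
  X-positive n = positive-⊆-∪-finite ideal (Z-positive (suc n)) split (below-finite (suc n))
    where
    split : Z (suc n) ⊆ (X n ∪ (_< suc n))
    split m m∈Z with n <? m
    ... | yes n<m = inj₁ (m∈Z , n<m)
    ... | no  n≮m = inj₂ (s≤s (≮⇒≥ n≮m))

  ys : ℕ → List ℕ
  ys = proj₁ (P⁺ X X-positive)

  ys⊆X : ∀ n → All (X n) (ys n)
  ys⊆X = proj₁ (proj₂ (P⁺ X X-positive))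

  Y : Subset
  Y m = Σ ℕ λ n → m ∈ ys n

  Y-positive : Positive I Y
  Y-positive = proj₂ (proj₂ (P⁺ X X-positive))

  bound : ℕ → ℕ
  bound zero    = max 0 (ys 0)
  bound (suc n) = max (bound n) (ys (suc n))

  ∈ys⇒≤bound : ∀ {m n} → m ∈ ys n → m ≤ bound n
  ∈ys⇒≤bound {n = zero}  m∈ys = All.lookup (xs≤max 0 (ys 0)) m∈ys
  ∈ys⇒≤bound {n = suc n} m∈ys = All.lookup (xs≤max (bound n) (ys (suc n))) m∈ys

  bound-mono : ∀ {m n} → m ≤ n → bound m ≤ bound n
  bound-mono = ≤-step-monotone _≤_ ≤-refl ≤-trans bound (λ n → ⊥≤max (bound n) (ys (suc n)))

  a : ℕ → ℕ
  a zero    = length s₀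
  a (suc j) = suc (a j + bound (a j))

  a-inc : StrictlyIncreasing a
  a-inc j = s≤s (m≤m+n (a j) _)

  ys-window : ∀ {j n m} → a j ≤ n → n < a (suc j) → m ∈ ys n →
              m ≤ a (suc (suc j)) × Z (suc (a j)) m
  ys-window {j} aj≤n n<aj+1 m∈ys =
    ≤-trans (∈ys⇒≤bound m∈ys) (≤-trans (bound-mono (<⇒≤ n<aj+1)) (≤-trans (m≤n+m _ (a (suc j))) (n≤1+n _))) ,
    antitone Z Z-decreasing (s≤s aj≤n) _ (proj₁ (All.lookup (ys⊆X _) m∈ys))

  evens odds : ℕ → ℕ
  evens k = a (twice k)
  odds  k = a (suc (twice k))

  evens-inc : StrictlyIncreasing evens
  evens-inc k = <-trans (a-inc (twice k)) (a-inc (suc (twice k)))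

  odds-inc : StrictlyIncreasing odds
  odds-inc k = <-trans (a-inc (suc (twice k))) (a-inc (suc (suc (twice k))))

  module Evens = LevelTree B evens-inc ≤-refl
  module Odds  = LevelTree B odds-inc (<⇒≤ (a-inc 0))

  Y⊆windows : Y ⊆ ((Window evens Z ∪ Window odds Z) ∪ (_< suc (bound (a 0))))
  Y⊆windows m (n , m∈ys) with a 0 ≤? n
  ... | no  a₀≰n = inj₂ (s≤s (≤-trans (∈ys⇒≤bound m∈ys) (bound-mono (<⇒≤ (≰⇒> a₀≰n)))))
  ... | yes a₀≤n with bracket a (suc n) a₀≤n (≤-<-trans (StrictlyIncreasing⇒inflationary a-inc n) (a-inc n))
  ...   | j , aj≤n , n<aj+1 with ys-window {j} aj≤n n<aj+1 m∈ys | even-or-odd j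
  ...     | window | k , inj₁ refl = inj₁ (inj₁ (k , window))
  ...     | window | k , inj₂ refl = inj₁ (inj₂ (k , window))

  homogeneousTree : HomogeneousTree I c
  homogeneousTree with positive-∪ ideal em (positive-⊆-∪-finite ideal Y-positive Y⊆windows (below-finite _))
  ... | inj₁ evens⁺ = Evens.p , Window evens Z , Evens.p-perfect , evens⁺ , Evens.p-constant
  ... | inj₂ odds⁺  = Odds.p  , Window odds Z  , Odds.p-perfect  , odds⁺  , Odds.p-constant

proposition3p3 : ExcludedMiddle 0ℓ → (I : Subset → Set) → IsIdeal I → IsP⁺ I → IsHL I
proposition3p3 em I ideal P⁺ c with extendable-dichotomy em ideal c
... | i , s₀ , ps₀ , ps₀⁺ , extend =
  Homogeneous.homogeneousTree em ideal P⁺ (Greedy.selection em c extend ps₀⁺)
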